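{- Let $M$ be a $3\times3$ semi-magic square with upshifted representative $\mathbf a=(a_1,\dots,a_6)$ and $m_0=\min(a_1,a_2,a_3)$. Let $\sigma$ be an element of the subgroup $H\subseteq S_6$ generated by $(12)$, $(23)$ and $(14)(25)(36)$, acting on sextuples by permuting positions, and let $M'$ be the semi-magic square represented by $\sigma\cdot\mathbf a$. If $\sigma$ preserves each of the sets $\{1,2,3\}$ and $\{4,5,6\}$, then $F(M,z)=F(M',z)$. Otherwise $M'$ has upshifted representative $\mathbf a'=\sigma\cdot\mathbf a+m_0(1,1,1,-1,-1,-1)$ and $$F(M,z)=z^{m_0}F(M',1/z).$$
   Context: A semi-magic square of size 3 is a $3\times 3$ matrix with non-negative integer entries whose row sums and column sums all equal a common value $\rho(M)$. Fix the permutation matrices $P_1=I$, $P_2=\begin{bmatrix}0&0&1\\1&0&0\\0&1&0\end{bmatrix}$, $P_3=\begin{bmatrix}0&1&0\\0&0&1\\1&0&0\end{bmatrix}$, $P_4=\begin{bmatrix}0&0&1\\0&1&0\\1&0&0\end{bmatrix}$, $P_5=\begin{bmatrix}0&1&0\\1&0&0\\0&0&1\end{bmatrix}$, $P_6=\begin{bmatrix}1&0&0\\0&0&1\\0&1&0\end{bmatrix}$. A non-negative integer sextuple $\mathbf a$ represents $M$ if $M=\sum_ta_tP_t$; representatives of the same square differ by integer multiples of $(1,1,1,-1,-1,-1)$, and the upshifted representative is the unique one with $a_t=0$ for some $t\in\{4,5,6\}$. The group $H$ is the image of the symmetry group $G\cong S_3\wr\mathbb Z/2$ (generated by row permutations,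 column permutations and transposition of $3\times 3$ matrices) acting on representing sextuples. For $M$ with upshifted representative $\mathbf a$ and $m_0=\min(a_1,a_2,a_3)$, $$F(M,z)=\sum_{t=0}^{m_0}\binom{\rho(M)}{a_1-t,\ a_2-t,\ a_3-t,\ a_4+t,\ a_5+t,\ a_6+t}z^t.$$ -}

module Defs where

open import Data.Nat as ℕ using (ℕ; zero; suc; _∸_; _⊓_; _<_)
import Data.Nat.Properties as ℕP
open import Data.Nat using (_!)
open import Relation.Nullary using (yes; no)
open import Data.Fin using (Fin; zero; suc; toℕ)
open import Data.Integer using (+_)
open import Data.Rational as ℚ using (ℚ; 0ℚ; 1ℚ)
open import Data.Product using (Σ; _×_; _,_)
open import Data.Sum using (_⊎_)
open import Relation.Binary.PropositionalEquality using (_≡_)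

-- 3×3 matrices, sextuples (index t ∈ Fin 6 stands for the paper's t+1)

Mat : Set
Mat = Fin 3 → Fin 3 → ℕ

Sext : Set
Sext = Fin 6 → ℕ

sum3 : (Fin 3 → ℕ) → ℕ
sum3 f = f zero ℕ.+ f (suc zero) ℕ.+ f (suc (suc zero))

sum6 : (Fin 6 → ℕ) → ℕ
sum6 f = f zero ℕ.+ f (suc zero) ℕ.+ f (suc (suc zero))
  ℕ.+ f (suc (suc (suc zero))) ℕ.+ f (suc (suc (suc (suc zero))))
  ℕ.+ f (suc (suc (suc (suc (suc zero)))))

SemiMagic : Mat → Set
SemiMagic M = Σ ℕ λ r → (∀ i → sum3 (M i) ≡ r) × (∀ j → sum3 (λ i → M i j) ≡ r)

ρ : Mat → ℕ
ρ M = sum3 (M zero)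

private
  f0 f1 f2 : Fin 3
  f0 = zero
  f1 = suc zero
  f2 = suc (suc zero)

  δ : Fin 3 → Fin 3 → ℕ
  δ zero zero = 1
  δ (suc zero) (suc zero) = 1
  δ (suc (suc zero)) (suc (suc zero)) = 1
  δ _ _ = 0

-- P t i = the column in which row i of P_{t+1} has its 1
permCol : Fin 6 → Fin 3 → Fin 3
permCol zero i = i
permCol (suc zero) zero = f2
permCol (suc zero) (suc zero) = f0
permCol (suc zero) (suc (suc zero)) = f1
permCol (suc (suc zero)) zero = f1
permCol (suc (suc zero)) (suc zero) = f2
permCol (suc (suc zero)) (suc (suc zero)) = f0
permCol (suc (suc (suc zero))) zero = f2
permCol (suc (suc (suc zero))) (suc zero) = f1
permCol (suc (suc (suc zero))) (suc (suc zero)) = f0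
permCol (suc (suc (suc (suc zero)))) zero = f1
permCol (suc (suc (suc (suc zero)))) (suc zero) = f0
permCol (suc (suc (suc (suc zero)))) (suc (suc zero)) = f2
permCol (suc (suc (suc (suc (suc zero))))) zero = f0
permCol (suc (suc (suc (suc (suc zero))))) (suc zero) = f2
permCol (suc (suc (suc (suc (suc zero))))) (suc (suc zero)) = f1

P : Fin 6 → Mat
P t i j = δ (permCol t i) j

Represents : Sext → Mat → Set
Represents a M = ∀ i j → M i j ≡ sum6 (λ t → a t ℕ.* P t i j)

Upshifted : Sext → Set
Upshifted a = a (suc (suc (suc zero))) ≡ 0
  ⊎ (a (suc (suc (suc (suc zero)))) ≡ 0 ⊎ a (suc (suc (suc (suc (suc zero))))) ≡ 0)

UpRep : Sext → Mat → Set
UpRep a M = Represents a M × Upshifted a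

m₀ : Sext → ℕ
m₀ a = a zero ⊓ a (suc zero) ⊓ a (suc (suc zero))

factProd : Sext → ℕ
factProd k = (k zero !) ℕ.* (k (suc zero) !) ℕ.* (k (suc (suc zero)) !)
  ℕ.* (k (suc (suc (suc zero))) !) ℕ.* (k (suc (suc (suc (suc zero)))) !)
  ℕ.* (k (suc (suc (suc (suc (suc zero))))) !)

nzMul : ∀ m n → ℕ.NonZero m → ℕ.NonZero n → ℕ.NonZero (m ℕ.* n)
nzMul m n p q = ℕP.m*n≢0 m n {{p}} {{q}}

factProd≢0 : ∀ k → ℕ.NonZero (factProd k)
factProd≢0 k = nzMul _ _ (nzMul _ _ (nzMul _ _ (nzMul _ _ (nzMul _ _ (nz (k zero)) (nz (k (suc zero)))) (nz (k (suc (suc zero))))) (nz (k (suc (suc (suc zero)))))) (nz (k (suc (suc (suc (suc zero))))))) (nz (k (suc (suc (suc (suc (suc zero)))))))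
  where
  nz : ∀ n → ℕ.NonZero (n !)
  nz n = ℕP._!≢0 n

multinomial : ℕ → Sext → ℕ
multinomial n k = ℕ._/_ (n !) (factProd k) {{factProd≢0 k}}

shiftDown : ℕ → Sext → Sext
shiftDown t a i with toℕ i ℕ.<? 3
... | yes _ = a i ∸ t
... | no _ = a i ℕ.+ t

_^ℚ_ : ℚ → ℕ → ℚ
z ^ℚ zero = 1ℚ
z ^ℚ suc n = z ℚ.* (z ^ℚ n)

sumTo : ℕ → (ℕ → ℚ) → ℚ
sumTo zero f = f 0
sumTo (suc n) f = sumTo n f ℚ.+ f (suc n)

-- F evaluated at z, given ρ(M) and the upshifted representative a of M:
--   Σ_{t=0}^{m₀} multinomial(ρ; a₁-t,a₂-t,a₃-t,a₄+t,a₅+t,a₆+t) z^t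
Fval : ℕ → Sext → ℚ → ℚ
Fval r a z = sumTo (m₀ a) λ t → (+ multinomial r (shiftDown t a) ℚ./ 1) ℚ.* (z ^ℚ t)

swap12 swap23 swapBlocks : Fin 6 → Fin 6
swap12 zero = suc zero
swap12 (suc zero) = zero
swap12 i = i
swap23 (suc zero) = suc (suc zero)
swap23 (suc (suc zero)) = suc zero
swap23 i = i
swapBlocks zero = suc (suc (suc zero))
swapBlocks (suc zero) = suc (suc (suc (suc zero)))
swapBlocks (suc (suc zero)) = suc (suc (suc (suc (suc zero))))
swapBlocks (suc (suc (suc zero))) = zero
swapBlocks (suc (suc (suc (suc zero)))) = suc zero
swapBlocks (suc (suc (suc (suc (suc zero))))) = suc (suc zero)

-- generated subgroup (finite, so closure under identity and composition
-- suffices; membership is up to pointwise equality)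
data InH : (Fin 6 → Fin 6) → Set where
  h-id   : InH (λ i → i)
  h-12   : InH swap12
  h-23   : InH swap23
  h-14   : InH swapBlocks
  h-comp : ∀ {σ τ} → InH σ → InH τ → InH (λ i → σ (τ i))
  h-ext  : ∀ {σ τ} → InH σ → (∀ i → σ i ≡ τ i) → InH τ

-- action on sextuples by permuting positions: (σ·a)_{σ(i)} = a_i
-- (encoded as (σ·a) i = a (σ i); since H is closed under inverses the
--  statement quantified over all σ ∈ H is unaffected by this convention)
act : (Fin 6 → Fin 6) → Sext → Sext
act σ a i = a (σ i)

PreservesBlocks : (Fin 6 → Fin 6) → Set
PreservesBlocks σ = ∀ i → (toℕ i < 3 → toℕ (σ i) < 3) × (toℕ (σ i) < 3 → toℕ i < 3)

matOf : Sext → Mat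
matOf a i j = sum6 (λ t → a t ℕ.* P t i j)

-- σ·a + m(1,1,1,-1,-1,-1)  (the subtraction is truncated; the statement
-- separately asserts that no truncation occurs)
shiftUp : ℕ → Sext → Sext
shiftUp m a i with toℕ i ℕ.<? 3
... | yes _ = a i ℕ.+ m
... | no _ = a i ∸ m

{-# OPTIONS --safe #-}
-- Every entry of Σ aₜPₜ is a sum a_p + a_q with p ∈ {1,2,3} and q ∈ {4,5,6}, each such pair
-- occurring in exactly one cell; so the pair sums determine the square, representatives differ by
-- multiples of (1,1,1,-1,-1,-1), and the one with a zero among a₄, a₅, a₆ is unique.
-- The generators of H, and hence all of H, either fix both blocks {1,2,3}, {4,5,6} or swap them,
-- while preserving Σ aₜ = ρ and the product of the factorials aₜ!.  A block-preserving σ thus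
-- maps the upshifted representative of M to that of M' and the t-th sextuple of F(M) to that of
-- F(M'), so the coefficients agree.  A block-swapping σ maps the (m₀ − t)-th sextuple of F(M)
-- to the t-th sextuple of F(M'), whose upshifted representative is a' = σ·a + m₀(1,1,1,-1,-1,-1);
-- reversing the coefficient sequence is exactly F(M, z) = z^m₀ F(M', 1/z).
module Submission where

open import Defs
open import Data.Nat using (ℕ; _<_; _≤_; _+_)
open import Data.Fin using (Fin; toℕ)
open import Data.Rational using (ℚ; NonZero; 1/_; _*_)
open import Data.Product using (_×_)
open import Relation.Nullary using (¬_)
open import Relation.Binary.PropositionalEquality using (_≡_)

open import Data.Bool using (Bool; true; false; not; _xor_)
open import Data.Bool.Properties using (xor-assoc; T-≡; ¬-not)
open import Data.Fin using (_↑ˡ_; _↑ʳ_)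
open import Data.Fin.Patterns using (0F; 1F; 2F; 3F; 4F; 5F)
import Data.Integer as ℤ
open import Data.Nat as ℕ using (zero; suc; _∸_; _⊓_; _!; _<?_; z≤n; s≤s)
open import Data.Nat.Properties
  using ( ⊓-comm; ⊓-assoc; ⊓-zeroʳ; m⊓n≤m; m⊓n≤n; ≤-trans; ≤⇒≯
        ; +-distribʳ-⊓; ∸-distribʳ-⊓; +-∸-assoc; ∸-+-assoc; m∸n+n≡m; m∸[m∸n]≡n
        ; ∸-monoˡ-≤; n∸n≡0; +-identityʳ; +-assoc; +-cancelˡ-≡; m+n≡0⇒m≡0
        ; m≤n⇒m≤1+n; ≤-refl; <ᵇ⇒<; <⇒<ᵇ)
open import Data.Nat.DivMod using (/-congʳ)
open import Data.Nat.Tactic.RingSolver using (solve-∀)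
open import Data.Product using (∃; ∃₂; _,_; proj₁; proj₂)
open import Data.Sum using (inj₁; inj₂)
open import Data.Rational using (1ℚ)
import Data.Rational as ℚ
import Data.Rational.Properties as ℚ
open import Data.Rational.Solver using (module +-*-Solver)
open import Function using (case_of_)
open import Function.Bundles using (Equivalence)
open import Relation.Nullary using (contradiction; yes; no)
open import Relation.Binary.PropositionalEquality
  using (refl; sym; trans; cong; cong₂; subst; _≗_; module ≡-Reasoning)

lo hi : Fin 3 → Fin 6
lo p = p ↑ˡ 3
hi q = 3 ↑ʳ q

sextuple-ext : ∀ {x y : Sext} →
               (∀ p → x (lo p) ≡ y (lo p)) → (∀ q → x (hi q) ≡ y (hi q)) → x ≗ y
sextuple-ext low high 0F = low 0F
sextuple-ext low high 1F = low 1F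
sextuple-ext low high 2F = low 2F
sextuple-ext low high 3F = high 0F
sextuple-ext low high 4F = high 1F
sextuple-ext low high 5F = high 2F

isLow : Fin 6 → Bool
isLow i = toℕ i ℕ.<ᵇ 3

isLow⇒< : ∀ i → isLow i ≡ true → toℕ i < 3
isLow⇒< i low = <ᵇ⇒< (toℕ i) 3 (Equivalence.from T-≡ low)

<⇒isLow : ∀ i → toℕ i < 3 → isLow i ≡ true
<⇒isLow i i<3 = Equivalence.to T-≡ (<⇒<ᵇ i<3)

≥⇒isLow≡false : ∀ i → 3 ≤ toℕ i → isLow i ≡ false
≥⇒isLow≡false i 3≤i = ¬-not λ low → ≤⇒≯ 3≤i (isLow⇒< i low)

isLow-lo : ∀ p → isLow (lo p) ≡ true
isLow-lo 0F = refl
isLow-lo 1F = refl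
isLow-lo 2F = refl

isLow-hi : ∀ q → isLow (hi q) ≡ false
isLow-hi 0F = refl
isLow-hi 1F = refl
isLow-hi 2F = refl

-- cell p q is the entry of Σ aₜPₜ equal to a (lo p) + a (hi q): mod 3 it is the (i , j)
-- with i − j ≡ p and i + j ≡ 2 − q.
cell : Fin 3 → Fin 3 → Fin 3 × Fin 3
cell 0F 0F = 1F , 1F
cell 0F 1F = 2F , 2F
cell 0F 2F = 0F , 0F
cell 1F 0F = 0F , 2F
cell 1F 1F = 1F , 0F
cell 1F 2F = 2F , 1F
cell 2F 0F = 2F , 0F
cell 2F 1F = 0F , 1F
cell 2F 2F = 1F , 2F

cell-surjective : ∀ i j → ∃₂ λ p q → cell p q ≡ (i , j)
cell-surjective 0F 0F = 0F , 2F , refl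
cell-surjective 0F 1F = 2F , 1F , refl
cell-surjective 0F 2F = 1F , 0F , refl
cell-surjective 1F 0F = 1F , 1F , refl
cell-surjective 1F 1F = 0F , 0F , refl
cell-surjective 1F 2F = 2F , 2F , refl
cell-surjective 2F 0F = 2F , 0F , refl
cell-surjective 2F 1F = 1F , 2F , refl
cell-surjective 2F 2F = 0F , 1F , refl

matOf-cell : ∀ x p q → matOf x (proj₁ (cell p q)) (proj₂ (cell p q)) ≡ x (lo p) + x (hi q)
matOf-cell x 0F 0F = collect (x 0F) (x 1F) (x 2F) (x 3F) (x 4F) (x 5F)
  where collect : ∀ a b c d e f → a ℕ.* 1 + b ℕ.* 0 + c ℕ.* 0 + d ℕ.* 1 + e ℕ.* 0 + f ℕ.* 0 ≡ a + d
        collect = solve-∀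
matOf-cell x 0F 1F = collect (x 0F) (x 1F) (x 2F) (x 3F) (x 4F) (x 5F)
  where collect : ∀ a b c d e f → a ℕ.* 1 + b ℕ.* 0 + c ℕ.* 0 + d ℕ.* 0 + e ℕ.* 1 + f ℕ.* 0 ≡ a + e
        collect = solve-∀
matOf-cell x 0F 2F = collect (x 0F) (x 1F) (x 2F) (x 3F) (x 4F) (x 5F)
  where collect : ∀ a b c d e f → a ℕ.* 1 + b ℕ.* 0 + c ℕ.* 0 + d ℕ.* 0 + e ℕ.* 0 + f ℕ.* 1 ≡ a + f
        collect = solve-∀
matOf-cell x 1F 0F = collect (x 0F) (x 1F) (x 2F) (x 3F) (x 4F) (x 5F)
  where collect : ∀ a b c d e f → a ℕ.* 0 + b ℕ.* 1 + c ℕ.* 0 + d ℕ.* 1 + e ℕ.* 0 + f ℕ.* 0 ≡ b + d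
        collect = solve-∀
matOf-cell x 1F 1F = collect (x 0F) (x 1F) (x 2F) (x 3F) (x 4F) (x 5F)
  where collect : ∀ a b c d e f → a ℕ.* 0 + b ℕ.* 1 + c ℕ.* 0 + d ℕ.* 0 + e ℕ.* 1 + f ℕ.* 0 ≡ b + e
        collect = solve-∀
matOf-cell x 1F 2F = collect (x 0F) (x 1F) (x 2F) (x 3F) (x 4F) (x 5F)
  where collect : ∀ a b c d e f → a ℕ.* 0 + b ℕ.* 1 + c ℕ.* 0 + d ℕ.* 0 + e ℕ.* 0 + f ℕ.* 1 ≡ b + f
        collect = solve-∀
matOf-cell x 2F 0F = collect (x 0F) (x 1F) (x 2F) (x 3F) (x 4F) (x 5F)
  where collect : ∀ a b c d e f → a ℕ.* 0 + b ℕ.* 0 + c ℕ.* 1 + d ℕ.* 1 + e ℕ.* 0 + f ℕ.* 0 ≡ c + d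
        collect = solve-∀
matOf-cell x 2F 1F = collect (x 0F) (x 1F) (x 2F) (x 3F) (x 4F) (x 5F)
  where collect : ∀ a b c d e f → a ℕ.* 0 + b ℕ.* 0 + c ℕ.* 1 + d ℕ.* 0 + e ℕ.* 1 + f ℕ.* 0 ≡ c + e
        collect = solve-∀
matOf-cell x 2F 2F = collect (x 0F) (x 1F) (x 2F) (x 3F) (x 4F) (x 5F)
  where collect : ∀ a b c d e f → a ℕ.* 0 + b ℕ.* 0 + c ℕ.* 1 + d ℕ.* 0 + e ℕ.* 0 + f ℕ.* 1 ≡ c + f
        collect = solve-∀

matOf-pairSums : ∀ x y → (∀ i j → matOf x i j ≡ matOf y i j) →
                 ∀ p q → x (lo p) + x (hi q) ≡ y (lo p) + y (hi q)
matOf-pairSums x y same p q = trans (sym (matOf-cell x p q)) (trans (same _ _) (matOf-cell y p q))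

pairSums-matOf : ∀ x y → (∀ p q → x (lo p) + x (hi q) ≡ y (lo p) + y (hi q)) →
                 ∀ i j → matOf x i j ≡ matOf y i j
pairSums-matOf x y same i j with cell-surjective i j
... | p , q , refl = trans (matOf-cell x p q) (trans (same p q) (sym (matOf-cell y p q)))

pairSums-injective : ∀ {I J : Set} {u u' : I → ℕ} {v v' : J → ℕ} →
                     (∀ p q → u p + v q ≡ u' p + v' q) →
                     ∃ (λ q → v q ≡ 0) → ∃ (λ q → v' q ≡ 0) →
                     ∀ p q → u p ≡ u' p × v q ≡ v' q
pairSums-injective {u = u} {u'} {v} {v'} same (q₁ , vq₁≡0) (q₀ , v'q₀≡0) p q = u≡u' , v≡v'
  where
  open ≡-Reasoning
  u+vq₀≡u' : u p + v q₀ ≡ u' p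
  u+vq₀≡u' = trans (same p q₀) (trans (cong (u' p +_) v'q₀≡0) (+-identityʳ _))
  u'+v'q₁≡u : u' p + v' q₁ ≡ u p
  u'+v'q₁≡u = trans (sym (same p q₁)) (trans (cong (u p +_) vq₁≡0) (+-identityʳ _))
  vq₀≡0 : v q₀ ≡ 0
  vq₀≡0 = m+n≡0⇒m≡0 (v q₀) (+-cancelˡ-≡ (u p) _ _ (begin
    u p + (v q₀ + v' q₁)  ≡⟨ sym (+-assoc (u p) _ _) ⟩
    u p + v q₀ + v' q₁    ≡⟨ cong (_+ v' q₁) u+vq₀≡u' ⟩
    u' p + v' q₁          ≡⟨ u'+v'q₁≡u ⟩
    u p                   ≡⟨ sym (+-identityʳ _) ⟩
    u p + 0               ∎))
  u≡u' : u p ≡ u' p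
  u≡u' = trans (sym (+-identityʳ _)) (trans (cong (u p +_) (sym vq₀≡0)) u+vq₀≡u')
  v≡v' : v q ≡ v' q
  v≡v' = +-cancelˡ-≡ (u p) _ _ (trans (same p q) (cong (_+ v' q) (sym u≡u')))

upshifted⇒hi≡0 : ∀ {x} → Upshifted x → ∃ λ q → x (hi q) ≡ 0
upshifted⇒hi≡0 (inj₁ x₃≡0)        = 0F , x₃≡0
upshifted⇒hi≡0 (inj₂ (inj₁ x₄≡0)) = 1F , x₄≡0
upshifted⇒hi≡0 (inj₂ (inj₂ x₅≡0)) = 2F , x₅≡0

upshifted-unique : ∀ {x y} → Upshifted x → Upshifted y →
                   (∀ i j → matOf x i j ≡ matOf y i j) → x ≗ y
upshifted-unique {x} {y} ux uy same =
  sextuple-ext (λ p → proj₁ (agree p 0F)) (λ q → proj₂ (agree 0F q))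
  where
  agree : ∀ p q → x (lo p) ≡ y (lo p) × x (hi q) ≡ y (hi q)
  agree = pairSums-injective (matOf-pairSums x y same) (upshifted⇒hi≡0 {x} ux) (upshifted⇒hi≡0 {y} uy)

minHigh : Sext → ℕ
minHigh x = x 3F ⊓ x 4F ⊓ x 5F

blockMin : Bool → Sext → ℕ
blockMin true  = m₀
blockMin false = minHigh

upshifted⇒minHigh≡0 : ∀ x → Upshifted x → minHigh x ≡ 0
upshifted⇒minHigh≡0 x (inj₁ x₃≡0)        rewrite x₃≡0 = refl
upshifted⇒minHigh≡0 x (inj₂ (inj₁ x₄≡0)) rewrite x₄≡0 | ⊓-zeroʳ (x 3F) = refl
upshifted⇒minHigh≡0 x (inj₂ (inj₂ x₅≡0)) rewrite x₅≡0 = ⊓-zeroʳ (x 3F ⊓ x 4F)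

minHigh≡0⇒upshifted : ∀ x → minHigh x ≡ 0 → Upshifted x
minHigh≡0⇒upshifted x min≡0 with x 3F | x 4F | x 5F
... | zero  | _     | _     = inj₁ refl
... | suc _ | zero  | _     = inj₂ (inj₁ refl)
... | suc _ | suc _ | zero  = inj₂ (inj₂ refl)
minHigh≡0⇒upshifted x () | suc _ | suc _ | suc _

m₀≤low : ∀ x i → isLow i ≡ true → m₀ x ≤ x i
m₀≤low x 0F _ = ≤-trans (m⊓n≤m _ _) (m⊓n≤m _ _)
m₀≤low x 1F _ = ≤-trans (m⊓n≤m _ _) (m⊓n≤n _ _)
m₀≤low x 2F _ = m⊓n≤n _ _

shiftDown-low : ∀ t x i → isLow i ≡ true → shiftDown t x i ≡ x i ∸ t
shiftDown-low t x i low with toℕ i <? 3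
... | yes _  = refl
... | no ¬lt = contradiction (isLow⇒< i low) ¬lt

shiftDown-high : ∀ t x i → isLow i ≡ false → shiftDown t x i ≡ x i + t
shiftDown-high t x i high with toℕ i <? 3
... | yes lt = case trans (sym (<⇒isLow i lt)) high of λ ()
... | no _   = refl

shiftUp-low : ∀ m x i → isLow i ≡ true → shiftUp m x i ≡ x i + m
shiftUp-low m x i low with toℕ i <? 3
... | yes _  = refl
... | no ¬lt = contradiction (isLow⇒< i low) ¬lt

shiftUp-high : ∀ m x i → isLow i ≡ false → shiftUp m x i ≡ x i ∸ m
shiftUp-high m x i high with toℕ i <? 3
... | yes lt = case trans (sym (<⇒isLow i lt)) high of λ ()
... | no _   = refl

shiftDown-cong : ∀ t {x y} → x ≗ y → shiftDown t x ≗ shiftDown t y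
shiftDown-cong t x≗y i with toℕ i <? 3
... | yes _ = cong (_∸ t) (x≗y i)
... | no _  = cong (_+ t) (x≗y i)

m₀-shiftUp : ∀ m x → m₀ (shiftUp m x) ≡ m₀ x + m
m₀-shiftUp m x = trans (cong (_⊓ (x 2F + m)) (sym (+-distribʳ-⊓ m (x 0F) (x 1F))))
                       (sym (+-distribʳ-⊓ m (x 0F ⊓ x 1F) (x 2F)))

minHigh-shiftUp : ∀ m x → minHigh (shiftUp m x) ≡ minHigh x ∸ m
minHigh-shiftUp m x = trans (cong (_⊓ (x 5F ∸ m)) (sym (∸-distribʳ-⊓ m (x 3F) (x 4F))))
                            (sym (∸-distribʳ-⊓ m (x 3F ⊓ x 4F) (x 5F)))

matOf-shiftUp : ∀ m x → (∀ q → m ≤ x (hi q)) → ∀ i j → matOf x i j ≡ matOf (shiftUp m x) i j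
matOf-shiftUp m x m≤high = pairSums-matOf x (shiftUp m x) λ p q → begin
  x (lo p) + x (hi q)            ≡⟨ cong (x (lo p) +_) (sym (m∸n+n≡m (m≤high q))) ⟩
  x (lo p) + (x (hi q) ∸ m + m)  ≡⟨ regroup (x (lo p)) (x (hi q) ∸ m) m ⟩
  x (lo p) + m + (x (hi q) ∸ m)  ≡⟨ sym (cong₂ _+_ (shiftUp-low m x (lo p) (isLow-lo p))
                                                     (shiftUp-high m x (hi q) (isLow-hi q))) ⟩
  shiftUp m x (lo p) + shiftUp m x (hi q) ∎
  where
  open ≡-Reasoning
  regroup : ∀ a b c → a + (b + c) ≡ a + c + b
  regroup = solve-∀

ρ≡sum6 : ∀ {M} x → Represents x M → ρ M ≡ sum6 x
ρ≡sum6 {M} x rep = begin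
  M 0F 0F + M 0F 1F + M 0F 2F
    ≡⟨ cong₂ _+_ (cong₂ _+_ (rep 0F 0F) (rep 0F 1F)) (rep 0F 2F) ⟩
  matOf x 0F 0F + matOf x 0F 1F + matOf x 0F 2F
    ≡⟨ cong₂ _+_ (cong₂ _+_ (matOf-cell x 0F 2F) (matOf-cell x 2F 1F)) (matOf-cell x 1F 0F) ⟩
  x 0F + x 5F + (x 2F + x 4F) + (x 1F + x 3F)
    ≡⟨ regroup (x 0F) (x 1F) (x 2F) (x 3F) (x 4F) (x 5F) ⟩
  sum6 x ∎
  where
  open ≡-Reasoning
  regroup : ∀ a b c d e f → a + f + (c + e) + (b + d) ≡ a + b + c + d + e + f
  regroup = solve-∀

sum6-cong : ∀ {x y} → x ≗ y → sum6 x ≡ sum6 y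
sum6-cong x≗y rewrite x≗y 0F | x≗y 1F | x≗y 2F | x≗y 3F | x≗y 4F | x≗y 5F = refl

factProd-cong : ∀ {x y} → x ≗ y → factProd x ≡ factProd y
factProd-cong x≗y rewrite x≗y 0F | x≗y 1F | x≗y 2F | x≗y 3F | x≗y 4F | x≗y 5F = refl

blockMin-cong : ∀ β {x y} → x ≗ y → blockMin β x ≡ blockMin β y
blockMin-cong true  x≗y rewrite x≗y 0F | x≗y 1F | x≗y 2F = refl
blockMin-cong false x≗y rewrite x≗y 3F | x≗y 4F | x≗y 5F = refl

record BlockSymmetry (σ : Fin 6 → Fin 6) : Set where
  field
    swapsBlocks  : Bool
    isLow-act    : ∀ i → isLow (σ i) ≡ swapsBlocks xor isLow i
    blockMin-act : ∀ β x → blockMin β (act σ x) ≡ blockMin (swapsBlocks xor β) x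
    sum6-act     : ∀ x → sum6 (act σ x) ≡ sum6 x
    factProd-act : ∀ x → factProd (act σ x) ≡ factProd x

open BlockSymmetry

id-symmetry : BlockSymmetry (λ i → i)
id-symmetry = record
  { swapsBlocks  = false
  ; isLow-act    = λ _ → refl
  ; blockMin-act = λ _ _ → refl
  ; sum6-act     = λ _ → refl
  ; factProd-act = λ _ → refl
  }

swap12-symmetry : BlockSymmetry swap12
swap12-symmetry = record
  { swapsBlocks  = false
  ; isLow-act    = λ { 0F → refl ; 1F → refl ; 2F → refl ; 3F → refl ; 4F → refl ; 5F → refl }
  ; blockMin-act = λ { true x → cong (_⊓ x 2F) (⊓-comm (x 1F) (x 0F)) ; false _ → refl }
  ; sum6-act     = λ x → sum (x 0F) (x 1F) (x 2F) (x 3F) (x 4F) (x 5F)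
  ; factProd-act = λ x → prod (x 0F !) (x 1F !) (x 2F !) (x 3F !) (x 4F !) (x 5F !)
  }
  where
  sum : ∀ a b c d e f → b + a + c + d + e + f ≡ a + b + c + d + e + f
  sum = solve-∀
  prod : ∀ a b c d e f → b ℕ.* a ℕ.* c ℕ.* d ℕ.* e ℕ.* f ≡ a ℕ.* b ℕ.* c ℕ.* d ℕ.* e ℕ.* f
  prod = solve-∀

swap23-symmetry : BlockSymmetry swap23
swap23-symmetry = record
  { swapsBlocks  = false
  ; isLow-act    = λ { 0F → refl ; 1F → refl ; 2F → refl ; 3F → refl ; 4F → refl ; 5F → refl }
  ; blockMin-act = λ { true x → min (x 0F) (x 1F) (x 2F) ; false _ → refl }
  ; sum6-act     = λ x → sum (x 0F) (x 1F) (x 2F) (x 3F) (x 4F) (x 5F)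
  ; factProd-act = λ x → prod (x 0F !) (x 1F !) (x 2F !) (x 3F !) (x 4F !) (x 5F !)
  }
  where
  min : ∀ a b c → a ⊓ c ⊓ b ≡ a ⊓ b ⊓ c
  min a b c = trans (⊓-assoc a c b) (trans (cong (a ⊓_) (⊓-comm c b)) (sym (⊓-assoc a b c)))
  sum : ∀ a b c d e f → a + c + b + d + e + f ≡ a + b + c + d + e + f
  sum = solve-∀
  prod : ∀ a b c d e f → a ℕ.* c ℕ.* b ℕ.* d ℕ.* e ℕ.* f ≡ a ℕ.* b ℕ.* c ℕ.* d ℕ.* e ℕ.* f
  prod = solve-∀

swapBlocks-symmetry : BlockSymmetry swapBlocks
swapBlocks-symmetry = record
  { swapsBlocks  = true
  ; isLow-act    = λ { 0F → refl ; 1F → refl ; 2F → refl ; 3F → refl ; 4F → refl ; 5F → refl }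
  ; blockMin-act = λ { true _ → refl ; false _ → refl }
  ; sum6-act     = λ x → sum (x 0F) (x 1F) (x 2F) (x 3F) (x 4F) (x 5F)
  ; factProd-act = λ x → prod (x 0F !) (x 1F !) (x 2F !) (x 3F !) (x 4F !) (x 5F !)
  }
  where
  sum : ∀ a b c d e f → d + e + f + a + b + c ≡ a + b + c + d + e + f
  sum = solve-∀
  prod : ∀ a b c d e f → d ℕ.* e ℕ.* f ℕ.* a ℕ.* b ℕ.* c ≡ a ℕ.* b ℕ.* c ℕ.* d ℕ.* e ℕ.* f
  prod = solve-∀

-- act reverses composition: act (λ i → σ (τ i)) is act τ ∘ act σ.
∘-symmetry : ∀ {σ τ} → BlockSymmetry σ → BlockSymmetry τ → BlockSymmetry (λ i → σ (τ i))
∘-symmetry {σ} {τ} S T = record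
  { swapsBlocks  = swapsBlocks S xor swapsBlocks T
  ; isLow-act    = λ i → trans (isLow-act S (τ i))
                     (trans (cong (swapsBlocks S xor_) (isLow-act T i))
                            (sym (xor-assoc (swapsBlocks S) (swapsBlocks T) (isLow i))))
  ; blockMin-act = λ β x → trans (blockMin-act T β (act σ x))
                     (trans (blockMin-act S (swapsBlocks T xor β) x)
                            (cong (λ γ → blockMin γ x) (sym (xor-assoc (swapsBlocks S) (swapsBlocks T) β))))
  ; sum6-act     = λ x → trans (sum6-act T (act σ x)) (sum6-act S x)
  ; factProd-act = λ x → trans (factProd-act T (act σ x)) (factProd-act S x)
  }

≗-symmetry : ∀ {σ τ} → BlockSymmetry σ → σ ≗ τ → BlockSymmetry τ
≗-symmetry {σ} {τ} S σ≗τ = record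
  { swapsBlocks  = swapsBlocks S
  ; isLow-act    = λ i → trans (cong isLow (sym (σ≗τ i))) (isLow-act S i)
  ; blockMin-act = λ β x → trans (blockMin-cong β (act-≗ x)) (blockMin-act S β x)
  ; sum6-act     = λ x → trans (sum6-cong (act-≗ x)) (sum6-act S x)
  ; factProd-act = λ x → trans (factProd-cong (act-≗ x)) (factProd-act S x)
  }
  where
  act-≗ : ∀ x → act τ x ≗ act σ x
  act-≗ x i = cong x (sym (σ≗τ i))

blockSymmetry : ∀ {σ} → InH σ → BlockSymmetry σ
blockSymmetry h-id           = id-symmetry
blockSymmetry h-12           = swap12-symmetry
blockSymmetry h-23           = swap23-symmetry
blockSymmetry h-14           = swapBlocks-symmetry
blockSymmetry (h-comp σ∈H τ∈H) = ∘-symmetry (blockSymmetry σ∈H) (blockSymmetry τ∈H)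
blockSymmetry (h-ext σ∈H σ≗τ)  = ≗-symmetry (blockSymmetry σ∈H) σ≗τ

swapsBlocks≡false⇒preservesBlocks : ∀ {σ} (S : BlockSymmetry σ) →
                                    swapsBlocks S ≡ false → PreservesBlocks σ
swapsBlocks≡false⇒preservesBlocks {σ} S s≡false i =
    (λ i<3 → isLow⇒< (σ i) (trans sameBlock (<⇒isLow i i<3)))
  , (λ σi<3 → isLow⇒< i (trans (sym sameBlock) (<⇒isLow (σ i) σi<3)))
  where
  sameBlock : isLow (σ i) ≡ isLow i
  sameBlock = trans (isLow-act S i) (cong (_xor isLow i) s≡false)

preservesBlocks⇒swapsBlocks≡false : ∀ {σ} (S : BlockSymmetry σ) →
                                    PreservesBlocks σ → swapsBlocks S ≡ false
preservesBlocks⇒swapsBlocks≡false {σ} S preserves = ¬-not λ s≡true →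
  case trans (sym (<⇒isLow (σ 0F) (proj₁ (preserves 0F) (s≤s z≤n))))
             (trans (isLow-act S 0F) (cong (_xor true) s≡true)) of λ ()

¬preservesBlocks⇒swapsBlocks≡true : ∀ {σ} (S : BlockSymmetry σ) →
                                    ¬ PreservesBlocks σ → swapsBlocks S ≡ true
¬preservesBlocks⇒swapsBlocks≡true S ¬preserves =
  ¬-not λ s≡false → ¬preserves (swapsBlocks≡false⇒preservesBlocks S s≡false)

coeff : ℕ → Sext → ℕ → ℚ
coeff r x t = ℤ.+ multinomial r (shiftDown t x) ℚ./ 1

coeff-cong : ∀ {r r'} x t x' t' → r ≡ r' → factProd (shiftDown t x) ≡ factProd (shiftDown t' x') →
             coeff r x t ≡ coeff r' x' t'
coeff-cong x t x' t' refl sameFactProd =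
  cong (λ n → ℤ.+ n ℚ./ 1)
       (/-congʳ {{factProd≢0 (shiftDown t x)}} {{factProd≢0 (shiftDown t' x')}} sameFactProd)

ρ-act : ∀ {σ M} → BlockSymmetry σ → ∀ x → Represents x M → ρ M ≡ ρ (matOf (act σ x))
ρ-act {σ} S x rep =
  trans (ρ≡sum6 x rep) (trans (sym (sum6-act S x)) (sym (ρ≡sum6 (act σ x) (λ _ _ → refl))))

sumTo-cong : ∀ {m n} {f g : ℕ → ℚ} → m ≡ n → (∀ t → t ≤ m → f t ≡ g t) → sumTo m f ≡ sumTo n g
sumTo-cong {zero}  refl f≗g = f≗g 0 z≤n
sumTo-cong {suc m} refl f≗g =
  cong₂ ℚ._+_ (sumTo-cong refl (λ t t≤m → f≗g t (m≤n⇒m≤1+n t≤m))) (f≗g (suc m) ≤-refl)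

sumTo-suc : ∀ n f → sumTo (suc n) f ≡ f 0 ℚ.+ sumTo n (λ t → f (suc t))
sumTo-suc zero    f = refl
sumTo-suc (suc n) f = trans (cong (ℚ._+ f (suc (suc n))) (sumTo-suc n f)) (ℚ.+-assoc (f 0) _ _)

sumTo-reverse : ∀ n f → sumTo n f ≡ sumTo n (λ t → f (n ∸ t))
sumTo-reverse zero    f = refl
sumTo-reverse (suc n) f = begin
  sumTo n f ℚ.+ f (suc n)                  ≡⟨ cong (ℚ._+ f (suc n)) (sumTo-reverse n f) ⟩
  sumTo n (λ t → f (n ∸ t)) ℚ.+ f (suc n)  ≡⟨ ℚ.+-comm (sumTo n (λ t → f (n ∸ t))) (f (suc n)) ⟩
  f (suc n) ℚ.+ sumTo n (λ t → f (n ∸ t))  ≡⟨ sym (sumTo-suc n (λ t → f (suc n ∸ t))) ⟩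
  sumTo (suc n) (λ t → f (suc n ∸ t))      ∎
  where open ≡-Reasoning

sumTo-*ˡ : ∀ n k f → sumTo n (λ t → k * f t) ≡ k * sumTo n f
sumTo-*ˡ zero    k f = refl
sumTo-*ˡ (suc n) k f = trans (cong (ℚ._+ (k * f (suc n))) (sumTo-*ˡ n k f)) (sym (ℚ.*-distribˡ-+ k _ _))

^ℚ-∸ : ∀ {z w} → w * z ≡ 1ℚ → ∀ {n t} → t ≤ n → z ^ℚ (n ∸ t) ≡ z ^ℚ n * w ^ℚ t
^ℚ-∸ {z} wz≡1 {n} z≤n = sym (ℚ.*-identityʳ (z ^ℚ n))
^ℚ-∸ {z} {w} wz≡1 {suc n} {suc t} (s≤s t≤n) = begin
  z ^ℚ (n ∸ t)               ≡⟨ ^ℚ-∸ wz≡1 t≤n ⟩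
  z ^ℚ n * w ^ℚ t            ≡⟨ sym (ℚ.*-identityʳ _) ⟩
  z ^ℚ n * w ^ℚ t * 1ℚ       ≡⟨ cong (z ^ℚ n * w ^ℚ t *_) (sym wz≡1) ⟩
  z ^ℚ n * w ^ℚ t * (w * z)  ≡⟨ regroup (z ^ℚ n) (w ^ℚ t) w z ⟩
  z * z ^ℚ n * (w * w ^ℚ t)  ∎
  where
  open ≡-Reasoning
  open +-*-Solver
  regroup : ∀ a b c d → a * b * (c * d) ≡ d * a * (c * b)
  regroup = solve 4 (λ a b c d → (a :* b) :* (c :* d) := (d :* a) :* (c :* b)) refl

sumTo-reciprocal : ∀ {z w} → w * z ≡ 1ℚ → ∀ n (c : ℕ → ℚ) →
                   sumTo n (λ t → c t * z ^ℚ t) ≡ z ^ℚ n * sumTo n (λ t → c (n ∸ t) * w ^ℚ t)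
sumTo-reciprocal {z} {w} wz≡1 n c = begin
  sumTo n (λ t → c t * z ^ℚ t)                       ≡⟨ sumTo-reverse n _ ⟩
  sumTo n (λ t → c (n ∸ t) * z ^ℚ (n ∸ t))           ≡⟨ sumTo-cong refl split ⟩
  sumTo n (λ t → z ^ℚ n * (c (n ∸ t) * w ^ℚ t))      ≡⟨ sumTo-*ˡ n (z ^ℚ n) _ ⟩
  z ^ℚ n * sumTo n (λ t → c (n ∸ t) * w ^ℚ t)        ∎
  where
  open ≡-Reasoning
  open +-*-Solver
  regroup : ∀ a b c → a * (b * c) ≡ b * (a * c)
  regroup = solve 3 (λ a b c → a :* (b :* c) := b :* (a :* c)) refl
  split : ∀ t → t ≤ n → c (n ∸ t) * z ^ℚ (n ∸ t) ≡ z ^ℚ n * (c (n ∸ t) * w ^ℚ t)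
  split t t≤n = trans (cong (c (n ∸ t) *_) (^ℚ-∸ wz≡1 t≤n)) (regroup (c (n ∸ t)) (z ^ℚ n) (w ^ℚ t))

m∸n+o≡m∸[n∸o] : ∀ {m n o} → o ≤ n → n ≤ m → m ∸ n + o ≡ m ∸ (n ∸ o)
m∸n+o≡m∸[n∸o] {m} {n} {o} o≤n n≤m = begin
  m ∸ n + o              ≡⟨ cong (λ k → m ∸ k + o) (sym (m∸n+n≡m o≤n)) ⟩
  m ∸ (n ∸ o + o) + o    ≡⟨ cong (_+ o) (sym (∸-+-assoc m (n ∸ o) o)) ⟩
  m ∸ (n ∸ o) ∸ o + o    ≡⟨ m∸n+n≡m o≤m∸[n∸o] ⟩
  m ∸ (n ∸ o)            ∎
  where
  open ≡-Reasoning
  o≤m∸[n∸o] : o ≤ m ∸ (n ∸ o)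
  o≤m∸[n∸o] = subst (_≤ m ∸ (n ∸ o)) (m∸[m∸n]≡n o≤n) (∸-monoˡ-≤ (n ∸ o) n≤m)

shiftDown-act : ∀ {σ} t x → (∀ i → isLow (σ i) ≡ isLow i) →
                shiftDown t (act σ x) ≗ act σ (shiftDown t x)
shiftDown-act {σ} t x sameBlock i = byBlock (isLow i) refl
  where
  byBlock : ∀ β → isLow i ≡ β → shiftDown t (act σ x) i ≡ shiftDown t x (σ i)
  byBlock true  low  = trans (shiftDown-low t (act σ x) i low)
                             (sym (shiftDown-low t x (σ i) (trans (sameBlock i) low)))
  byBlock false high = trans (shiftDown-high t (act σ x) i high)
                             (sym (shiftDown-high t x (σ i) (trans (sameBlock i) high)))

shiftDown-shiftUp-act : ∀ {σ} m t x → (∀ i → isLow (σ i) ≡ not (isLow i)) →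
                        (∀ i → isLow i ≡ true → m ≤ x i) → t ≤ m →
                        shiftDown t (shiftUp m (act σ x)) ≗ act σ (shiftDown (m ∸ t) x)
shiftDown-shiftUp-act {σ} m t x flipsBlock m≤low t≤m i = byBlock (isLow i) refl
  where
  open ≡-Reasoning
  byBlock : ∀ β → isLow i ≡ β → shiftDown t (shiftUp m (act σ x)) i ≡ shiftDown (m ∸ t) x (σ i)
  byBlock true low = begin
    shiftDown t (shiftUp m (act σ x)) i  ≡⟨ shiftDown-low t (shiftUp m (act σ x)) i low ⟩
    shiftUp m (act σ x) i ∸ t            ≡⟨ cong (_∸ t) (shiftUp-low m (act σ x) i low) ⟩
    x (σ i) + m ∸ t                      ≡⟨ +-∸-assoc (x (σ i)) t≤m ⟩
    x (σ i) + (m ∸ t)                    ≡⟨ sym (shiftDown-high (m ∸ t) x (σ i) σi-high) ⟩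
    shiftDown (m ∸ t) x (σ i)            ∎
    where
    σi-high : isLow (σ i) ≡ false
    σi-high = trans (flipsBlock i) (cong not low)
  byBlock false high = begin
    shiftDown t (shiftUp m (act σ x)) i  ≡⟨ shiftDown-high t (shiftUp m (act σ x)) i high ⟩
    shiftUp m (act σ x) i + t            ≡⟨ cong (_+ t) (shiftUp-high m (act σ x) i high) ⟩
    x (σ i) ∸ m + t                      ≡⟨ m∸n+o≡m∸[n∸o] t≤m (m≤low (σ i) σi-low) ⟩
    x (σ i) ∸ (m ∸ t)                    ≡⟨ sym (shiftDown-low (m ∸ t) x (σ i) σi-low) ⟩
    shiftDown (m ∸ t) x (σ i)            ∎
    where
    σi-low : isLow (σ i) ≡ true
    σi-low = trans (flipsBlock i) (cong not high)

Fval-invariant : ∀ {σ M a b} (S : BlockSymmetry σ) → swapsBlocks S ≡ false →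
                 UpRep a M → UpRep b (matOf (act σ a)) →
                 ∀ z → Fval (ρ M) a z ≡ Fval (ρ (matOf (act σ a))) b z
Fval-invariant {σ} {M} {a} {b} S s≡false (rep , up) (rep-b , up-b) z =
  sumTo-cong (sym m₀b≡m₀a) λ t _ →
    cong (_* z ^ℚ t) (coeff-cong a t b t (ρ-act S a rep) (sym (sameFactProd t)))
  where
  y : Sext
  y = act σ a
  sameBlock : ∀ i → isLow (σ i) ≡ isLow i
  sameBlock i = trans (isLow-act S i) (cong (_xor isLow i) s≡false)
  sameBlockMin : ∀ β → blockMin β y ≡ blockMin β a
  sameBlockMin β = trans (blockMin-act S β a) (cong (λ s → blockMin (s xor β) a) s≡false)
  b≗y : b ≗ y
  b≗y = upshifted-unique {b} {y} up-b
          (minHigh≡0⇒upshifted y (trans (sameBlockMin false) (upshifted⇒minHigh≡0 a up)))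
          (λ i j → sym (rep-b i j))
  m₀b≡m₀a : m₀ b ≡ m₀ a
  m₀b≡m₀a = trans (blockMin-cong true b≗y) (sameBlockMin true)
  sameFactProd : ∀ t → factProd (shiftDown t b) ≡ factProd (shiftDown t a)
  sameFactProd t = trans (factProd-cong (shiftDown-cong t b≗y))
                         (trans (factProd-cong (shiftDown-act {σ} t a sameBlock))
                                (factProd-act S (shiftDown t a)))

module BlockSwapping {σ} (S : BlockSymmetry σ) (s≡true : swapsBlocks S ≡ true)
                     {M a} (rep : Represents a M) (up : Upshifted a) where

  y : Sext
  y = act σ a

  a' : Sext
  a' = shiftUp (m₀ a) y

  flipsBlock : ∀ i → isLow (σ i) ≡ not (isLow i)
  flipsBlock i = trans (isLow-act S i) (cong (_xor isLow i) s≡true)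

  swappedBlockMin : ∀ β → blockMin β y ≡ blockMin (not β) a
  swappedBlockMin β = trans (blockMin-act S β a) (cong (λ s → blockMin (s xor β) a) s≡true)

  m₀≤high : ∀ i → isLow i ≡ false → m₀ a ≤ y i
  m₀≤high i high = m₀≤low a (σ i) (trans (flipsBlock i) (cong not high))

  a'-low : ∀ i → toℕ i < 3 → a' i ≡ y i + m₀ a
  a'-low i i<3 = shiftUp-low (m₀ a) y i (<⇒isLow i i<3)

  a'-high : ∀ i → 3 ≤ toℕ i → a' i + m₀ a ≡ y i
  a'-high i 3≤i = trans (cong (_+ m₀ a) (shiftUp-high (m₀ a) y i high))
                        (m∸n+n≡m (m₀≤high i high))
    where
    high : isLow i ≡ false
    high = ≥⇒isLow≡false i 3≤i

  a'-upRep : UpRep a' (matOf y)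
  a'-upRep = matOf-shiftUp (m₀ a) y (λ q → m₀≤high (hi q) (isLow-hi q))
           , minHigh≡0⇒upshifted a'
               (trans (minHigh-shiftUp (m₀ a) y)
                      (trans (cong (_∸ m₀ a) (swappedBlockMin false)) (n∸n≡0 (m₀ a))))

  m₀a'≡m₀a : m₀ a' ≡ m₀ a
  m₀a'≡m₀a = trans (m₀-shiftUp (m₀ a) y)
                   (cong (_+ m₀ a) (trans (swappedBlockMin true) (upshifted⇒minHigh≡0 a up)))

  coeff-reversed : ∀ t → t ≤ m₀ a → coeff (ρ M) a (m₀ a ∸ t) ≡ coeff (ρ (matOf y)) a' t
  coeff-reversed t t≤m₀ = coeff-cong a (m₀ a ∸ t) a' t (ρ-act S a rep) (sym (trans
    (factProd-cong (shiftDown-shiftUp-act {σ} (m₀ a) t a flipsBlock (m₀≤low a) t≤m₀))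
    (factProd-act S (shiftDown (m₀ a ∸ t) a))))

  Fval-reciprocal : (z : ℚ) .{{_ : NonZero z}} →
                    Fval (ρ M) a z ≡ z ^ℚ m₀ a * Fval (ρ (matOf y)) a' (1/ z)
  Fval-reciprocal z = trans (sumTo-reciprocal (ℚ.*-inverseˡ z) (m₀ a) (coeff (ρ M) a))
    (cong (z ^ℚ m₀ a *_) (sumTo-cong (sym m₀a'≡m₀a) λ t t≤m₀ →
      cong (_* (1/ z) ^ℚ t) (coeff-reversed t t≤m₀)))

proposition7p3 :
    (M : Mat) (a : Sext) → SemiMagic M → UpRep a M →
    (σ : Fin 6 → Fin 6) → InH σ →
    (PreservesBlocks σ →
       (b : Sext) → UpRep b (matOf (act σ a)) →
       (z : ℚ) → Fval (ρ M) a z ≡ Fval (ρ (matOf (act σ a))) b z)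
    ×
    (¬ PreservesBlocks σ →
       ((i : Fin 6) → toℕ i < 3 → shiftUp (m₀ a) (act σ a) i ≡ act σ a i + m₀ a)
       × ((i : Fin 6) → 3 ≤ toℕ i → shiftUp (m₀ a) (act σ a) i + m₀ a ≡ act σ a i)
       × UpRep (shiftUp (m₀ a) (act σ a)) (matOf (act σ a))
       × ((z : ℚ) .{{_ : NonZero z}} →
            Fval (ρ M) a z
              ≡ (z ^ℚ m₀ a) * Fval (ρ (matOf (act σ a))) (shiftUp (m₀ a) (act σ a)) (1/ z)))
proposition7p3 M a _ (rep , up) σ σ∈H =
    (λ preserves b upRep-b →
       Fval-invariant {σ} {M} {a} {b} S (preservesBlocks⇒swapsBlocks≡false S preserves)
                      (rep , up) upRep-b)
  , (λ ¬preserves →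
       let open BlockSwapping S (¬preservesBlocks⇒swapsBlocks≡true S ¬preserves) {M} {a} rep up
       in a'-low , a'-high , a'-upRep , Fval-reciprocal)
  where
  S : BlockSymmetry σ
  S = blockSymmetry σ∈H
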